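{- (Bolzano–Weierstrass Theorem.) For all $\gamma\in\omega^\omega$: if $\forall\zeta\in[\omega]^\omega\,\exists n\big[\frac{1}{2^n}<|q_{\gamma(\zeta(n))}-q_{\gamma(\zeta(n+1))}|\big]$, then $\exists n[1<|q_{\gamma(n)}|]$.
   Context: Setting: intuitionistic mathematics (intuitionistic logic), assuming the axioms of countable choice and Brouwer's Bar Theorem in the form of Bar Induction: if $B,C\subseteq\omega$, $B$ is a bar in $\omega^\omega$ (i.e. $\forall\alpha\exists n[\langle\alpha(0),\dots,\alpha(n-1)\rangle\in B]$, finite sequences coded by numbers), $B\subseteq C$ and $\forall s[s\in C\leftrightarrow\forall n[s\ast\langle n\rangle\in C]]$, then $\langle\,\rangle\in C$. $q_0,q_1,\dots$ is a fixed enumeration of the rationals $\mathbb{Q}$. $[\omega]^\omega=\{\zeta\in\omega^\omega\mid\forall n[\zeta(n)<\zeta(n+1)]\}$. -}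

module Defs where

open import Data.Nat using (ℕ; zero; suc; _<_)
open import Data.List using (List; []; _∷_; _++_; [_])
open import Data.Product using (∃; _×_)
open import Data.Rational using (ℚ; 1ℚ; ½; _*_)
open import Function.Definitions using (Surjective)
open import Relation.Binary.PropositionalEquality using (_≡_)

-- finite sequences are represented directly as lists of naturals
-- (instead of numeric codes); s ∗ ⟨n⟩ is  s ++ [ n ].

initSeg : (ℕ → ℕ) → ℕ → List ℕ
initSeg α zero = []
initSeg α (suc n) = initSeg α n ++ [ α n ]

IsBar : (List ℕ → Set) → Set
IsBar B = ∀ (α : ℕ → ℕ) → ∃ λ n → B (initSeg α n)

BarInduction : Set₁
BarInduction =
  ∀ (B C : List ℕ → Set) →
  IsBar B →
  (∀ s → B s → C s) →
  (∀ s → (C s → ∀ n → C (s ++ [ n ])) × ((∀ n → C (s ++ [ n ])) → C s)) →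
  C []

StrictlyIncreasing : (ℕ → ℕ) → Set
StrictlyIncreasing ζ = ∀ n → ζ n < ζ (suc n)

halfPow : ℕ → ℚ
halfPow zero = 1ℚ
halfPow (suc n) = ½ * halfPow n

IsEnumerationℚ : (ℕ → ℚ) → Set
IsEnumerationℚ q = Surjective _≡_ _≡_ q

-- Bisect [-1, 1] over and over, each time choosing a later term of x in the
-- current interval and keeping the half that contains it.  By hypothesis, along
-- every path of this tree of choices some two consecutive chosen terms lie more
-- than 2⁻ⁿ apart, where legal choices would have put both in one interval of
-- width 2⁻ⁿ; so the nodes at which a chosen term missed its interval form a bar.
-- Bar induction then shows, for every node whose choices were all legal, that
-- its interval holds the later terms only almost-finitely often: an interval is
-- the union of its two halves, every term in a half leads to a child, and
-- almost-finite sets are closed under finite unions.  At the root this says that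
-- the sequence itself leaves [-1, 1].
module Submission where

open import Defs
open import Data.Nat using (ℕ; suc)
open import Data.Product using (∃)
open import Data.Rational using (ℚ; 1ℚ; ∣_∣; _-_; _<_)

open import Data.Empty using (⊥-elim)
open import Data.List using (List; []; _∷_; _++_; [_]; foldl)
open import Data.List.Properties using (foldl-++; ++-assoc; ++-identityʳ)
open import Data.Nat as ℕ using (zero; z≤n; s≤s; _≤′_; ≤′-refl; ≤′-step)
import Data.Nat.Properties as ℕₚ
open import Data.Product using (Σ; _×_; _,_; proj₁; proj₂)
open import Data.Rational using (½; -_; _+_; _*_; _≤_)
open import Data.Rational.Properties as ℚₚ using (_<?_; _≤?_)
open import Data.Rational.Solver using (module +-*-Solver)
open import Data.Sum using (_⊎_; inj₁; inj₂)
open import Data.Unit using (⊤; tt)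
open import Function using (_∘_; id)
open import Relation.Nullary using (¬_; Dec; yes; no; ¬?; _×-dec_)
open import Relation.Binary.PropositionalEquality
  using (_≡_; refl; sym; trans; cong; subst; module ≡-Reasoning)

barInduction-backward : BarInduction → (B C : List ℕ → Set) → IsBar B →
  (∀ s t → B s → C (s ++ t)) →
  (∀ s → (∀ n → C (s ++ [ n ])) → C s) →
  C []
barInduction-backward BI B C bar B⇒C backward =
  BI B C⁺ bar (λ s b t → B⇒C s t b) (λ s → forward s , backward⁺ s) []
  where
    -- C⁺ is hereditary by construction, which is what the forward clause of BI demands.
    C⁺ : List ℕ → Set
    C⁺ s = ∀ t → C (s ++ t)

    forward : ∀ s → C⁺ s → ∀ n → C⁺ (s ++ [ n ])
    forward s c n t = subst C (sym (++-assoc s [ n ] t)) (c (n ∷ t))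

    backward⁺ : ∀ s → (∀ n → C⁺ (s ++ [ n ])) → C⁺ s
    backward⁺ s h [] = subst C (sym (++-identityʳ s))
      (backward s (λ n → subst C (++-identityʳ (s ++ [ n ])) (h n [])))
    backward⁺ s h (n ∷ t) = subst C (++-assoc s [ n ] t) (h n t)

module _ {ζ : ℕ → ℕ} (ζ-inc : StrictlyIncreasing ζ) where

  strictlyIncreasing-mono-≤ : ∀ {m n} → m ℕ.≤ n → ζ m ℕ.≤ ζ n
  strictlyIncreasing-mono-≤ = go ∘ ℕₚ.≤⇒≤′
    where
      go : ∀ {m n} → m ≤′ n → ζ m ℕ.≤ ζ n
      go ≤′-refl = ℕₚ.≤-refl
      go (≤′-step m≤′n) = ℕₚ.≤-trans (go m≤′n) (ℕₚ.<⇒≤ (ζ-inc _))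

  strictlyIncreasing-mono-< : ∀ {m n} → m ℕ.< n → ζ m ℕ.< ζ n
  strictlyIncreasing-mono-< m<n = ℕₚ.<-≤-trans (ζ-inc _) (strictlyIncreasing-mono-≤ m<n)

  strictlyIncreasing-∘ : ∀ {σ} → StrictlyIncreasing σ → StrictlyIncreasing (ζ ∘ σ)
  strictlyIncreasing-∘ σ-inc j = strictlyIncreasing-mono-< (σ-inc j)

-- Veldman's almost-finiteness of {n ≥ i ∣ P n}, the intuitionistic substitute
-- for finiteness: every strictly increasing sequence of indices from i on leaves P.
AlmostFiniteFrom : ℕ → (ℕ → Set) → Set
AlmostFiniteFrom i P = ∀ ζ → StrictlyIncreasing ζ → i ℕ.≤ ζ 0 → ∃ λ m → ¬ P (ζ m)

module _ {i : ℕ} {P : ℕ → Set} where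

  almostFiniteFrom-⊆ : {Q : ℕ → Set} → (∀ {n} → Q n → P n) →
                       AlmostFiniteFrom i P → AlmostFiniteFrom i Q
  almostFiniteFrom-⊆ Q⊆P P-af ζ ζ-inc i≤ζ₀ =
    let m , ¬P = P-af ζ ζ-inc i≤ζ₀ in m , ¬P ∘ Q⊆P

  subsequence-avoiding : AlmostFiniteFrom i P → ∀ {ζ} → StrictlyIncreasing ζ → i ℕ.≤ ζ 0 →
                         Σ (ℕ → ℕ) λ σ → StrictlyIncreasing σ × (∀ j → ¬ P (ζ (σ j)))
  subsequence-avoiding P-af {ζ} ζ-inc i≤ζ₀ = σ , σ-inc , proj₂ ∘ leave ∘ start
    where
      leave : ∀ k → ∃ λ m → ¬ P (ζ (m ℕ.+ k))
      leave k = P-af (λ m → ζ (m ℕ.+ k)) (λ m → ζ-inc (m ℕ.+ k))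
                     (ℕₚ.≤-trans i≤ζ₀ (strictlyIncreasing-mono-≤ ζ-inc z≤n))

      start : ℕ → ℕ
      start zero = 0
      start (suc j) = suc (proj₁ (leave (start j)) ℕ.+ start j)

      σ : ℕ → ℕ
      σ j = proj₁ (leave (start j)) ℕ.+ start j

      σ-inc : StrictlyIncreasing σ
      σ-inc j = ℕₚ.m≤n+m (start (suc j)) (proj₁ (leave (start (suc j))))

  almostFiniteFrom-∪ : {Q : ℕ → Set} → AlmostFiniteFrom i P → AlmostFiniteFrom i Q →
                       AlmostFiniteFrom i (λ n → P n ⊎ Q n)
  almostFiniteFrom-∪ P-af Q-af ζ ζ-inc i≤ζ₀ =
    let σ , σ-inc , ¬P = subsequence-avoiding P-af ζ-inc i≤ζ₀
        m , ¬Q = Q-af (ζ ∘ σ) (strictlyIncreasing-∘ ζ-inc σ-inc)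
                      (ℕₚ.≤-trans i≤ζ₀ (strictlyIncreasing-mono-≤ ζ-inc z≤n))
    in σ m , λ { (inj₁ p) → ¬P m p ; (inj₂ q) → ¬Q q }

  almostFiniteFrom-step : (∀ n → Dec (P n)) →
                          (∀ n → i ℕ.≤ n → P n → AlmostFiniteFrom (suc n) P) →
                          AlmostFiniteFrom i P
  almostFiniteFrom-step P? later ζ ζ-inc i≤ζ₀ with P? (ζ 0)
  ... | no ¬P = 0 , ¬P
  ... | yes P₀ = let m , ¬P = later (ζ 0) i≤ζ₀ P₀ (ζ ∘ suc) (ζ-inc ∘ suc) (ζ-inc 0)
                 in suc m , ¬P

record Interval : Set where
  constructor [_,+_]
  field
    lo width : ℚ
open Interval

infix 4 _∈_ _∈?_

_∈_ : ℚ → Interval → Set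
y ∈ [ a ,+ w ] = a ≤ y × y ≤ a + w

_∈?_ : ∀ y J → Dec (y ∈ J)
y ∈? [ a ,+ w ] = (a ≤? y) ×-dec (y ≤? a + w)

midpoint : Interval → ℚ
midpoint [ a ,+ w ] = a + ½ * w

lowerHalf upperHalf : Interval → Interval
lowerHalf [ a ,+ w ] = [ a ,+ ½ * w ]
upperHalf [ a ,+ w ] = [ a + ½ * w ,+ ½ * w ]

halfContaining : ℚ → Interval → Interval
halfContaining y J with y <? midpoint J
... | yes _ = lowerHalf J
... | no _ = upperHalf J

module _ {y : ℚ} {J : Interval} where

  halfContaining-lower : y < midpoint J → halfContaining y J ≡ lowerHalf J
  halfContaining-lower y<m with y <? midpoint J
  ... | yes _ = refl
  ... | no y≮m = ⊥-elim (y≮m y<m)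

  halfContaining-upper : ¬ y < midpoint J → halfContaining y J ≡ upperHalf J
  halfContaining-upper y≮m with y <? midpoint J
  ... | yes y<m = ⊥-elim (y≮m y<m)
  ... | no _ = refl

  width-halfContaining : width (halfContaining y J) ≡ ½ * width J
  width-halfContaining with y <? midpoint J
  ... | yes _ = refl
  ... | no _ = refl

  ∈-lowerHalf : y ∈ J → y < midpoint J → y ∈ lowerHalf J
  ∈-lowerHalf (a≤y , _) y<m = a≤y , ℚₚ.<⇒≤ y<m

  ∈-upperHalf : y ∈ J → ¬ y < midpoint J → y ∈ upperHalf J
  ∈-upperHalf (_ , y≤a+w) y≮m = ℚₚ.≮⇒≥ y≮m , subst (y ≤_) (sym upper-end) y≤a+w
    where
      open ≡-Reasoning
      a = lo J
      w = width J
      upper-end : (a + ½ * w) + ½ * w ≡ a + w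
      upper-end = begin
        (a + ½ * w) + ½ * w  ≡⟨ ℚₚ.+-assoc a (½ * w) (½ * w) ⟩
        a + (½ * w + ½ * w)  ≡⟨ cong (a +_) (sym (ℚₚ.*-distribʳ-+ w ½ ½)) ⟩
        a + (1ℚ * w)         ≡⟨ cong (a +_) (ℚₚ.*-identityˡ w) ⟩
        a + w                ∎

  ∈-halfContaining : y ∈ J → y ∈ halfContaining y J
  ∈-halfContaining y∈J with y <? midpoint J
  ... | yes y<m = ∈-lowerHalf y∈J y<m
  ... | no y≮m = ∈-upperHalf y∈J y≮m

∣p∣≤q : ∀ {p q} → p ≤ q → - p ≤ q → ∣ p ∣ ≤ q
∣p∣≤q {p} p≤q -p≤q with ℚₚ.∣p∣≡p∨∣p∣≡-p p
... | inj₁ ∣p∣≡p = subst (_≤ _) (sym ∣p∣≡p) p≤q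
... | inj₂ ∣p∣≡-p = subst (_≤ _) (sym ∣p∣≡-p) -p≤q

∈⇒∣-∣≤width : ∀ {y z J} → y ∈ J → z ∈ J → ∣ y - z ∣ ≤ width J
∈⇒∣-∣≤width {y} {z} {J} y∈J z∈J =
  ∣p∣≤q (difference≤width y∈J z∈J)
        (subst (_≤ width J) (sym (neg-difference y z)) (difference≤width z∈J y∈J))
  where
    open +-*-Solver

    neg-difference : ∀ y z → - (y - z) ≡ z - y
    neg-difference = solve 2 (λ y z → :- (y :- z) := z :- y) refl

    a+w-a≡w : ∀ a w → (a + w) - a ≡ w
    a+w-a≡w = solve 2 (λ a w → (a :+ w) :- a := w) refl

    difference≤width : ∀ {y z} → y ∈ J → z ∈ J → y - z ≤ width J
    difference≤width (_ , y≤a+w) (a≤z , _) =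
      subst (_ ≤_) (a+w-a≡w (lo J) (width J)) (ℚₚ.+-mono-≤ y≤a+w (ℚₚ.neg-antimono-≤ a≤z))

1<p⇒1<∣p∣ : ∀ {p} → 1ℚ < p → 1ℚ < ∣ p ∣
1<p⇒1<∣p∣ 1<p = subst (1ℚ <_)
  (sym (ℚₚ.0≤p⇒∣p∣≡p (ℚₚ.<⇒≤ (ℚₚ.<-trans (ℚₚ.positive⁻¹ 1ℚ) 1<p)))) 1<p

∉[-1,1]⇒1<∣y∣ : ∀ y → ¬ (y ∈ [ - 1ℚ ,+ 1ℚ + 1ℚ ]) → 1ℚ < ∣ y ∣
∉[-1,1]⇒1<∣y∣ y y∉ with 1ℚ <? y | y <? - 1ℚ
... | yes 1<y | _ = 1<p⇒1<∣p∣ 1<y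
... | no _ | yes y<-1 = subst (1ℚ <_) (ℚₚ.∣-p∣≡∣p∣ y) (1<p⇒1<∣p∣ (ℚₚ.neg-antimono-< y<-1))
... | no 1≮y | no y≮-1 = ⊥-elim (y∉ (ℚₚ.≮⇒≥ y≮-1 , ℚₚ.≮⇒≥ 1≮y))

-- Choosing the index n ≥ next leads to the
-- child that keeps the half of the interval containing x n; the child's choice is
-- legal only if x n lies in the interval being halved, and Admissible collects
-- the legality of all choices on the way.
record Node : Set₁ where
  constructor node
  field
    next : ℕ
    interval : Interval
    Admissible : Set
open Node

module BisectionTree (x : ℕ → ℚ) where

  extend : Node → ℕ → Node
  extend (node _ J A) n = node (suc n) (halfContaining (x n) J) (A × x n ∈ J)

  root : Node
  root = node 0 [ - 1ℚ ,+ 1ℚ + 1ℚ ] ⊤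

  -- A list of choices d₀ d₁ … is read as offsets: d picks the index next + d.
  nodeAt : List ℕ → Node
  nodeAt = foldl (λ N d → extend N (next N ℕ.+ d)) root

  nodeAt-snoc : ∀ s d → nodeAt (s ++ [ d ]) ≡ extend (nodeAt s) (next (nodeAt s) ℕ.+ d)
  nodeAt-snoc s = foldl-++ _ root s ∘ [_]

  admissible-prefix : ∀ s t → Admissible (nodeAt (s ++ t)) → Admissible (nodeAt s)
  admissible-prefix s t = go t (nodeAt s) ∘ subst Admissible (foldl-++ _ root s t)
    where
      go : ∀ t N → Admissible (foldl (λ N d → extend N (next N ℕ.+ d)) N t) → Admissible N
      go [] N A = A
      go (d ∷ t) N A = proj₁ (go t (extend N (next N ℕ.+ d)) A)

  Sparse : Node → Set
  Sparse N = AlmostFiniteFrom (next N) (λ n → x n ∈ interval N)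

  sparse-backward : ∀ N → (∀ n → next N ℕ.≤ n → Admissible (extend N n) → Sparse (extend N n)) →
                    Admissible N → Sparse N
  sparse-backward (node i J A) children A-holds =
    almostFiniteFrom-⊆ {P = λ n → Lower n ⊎ Upper n} split
      (almostFiniteFrom-∪ {P = Lower} {Q = Upper}
                          (onHalf (_< midpoint J) (_<? midpoint J) (lowerHalf J)
                                  halfContaining-lower ∈-lowerHalf)
                          (onHalf (λ y → ¬ y < midpoint J) (λ y → ¬? (y <? midpoint J)) (upperHalf J)
                                  halfContaining-upper ∈-upperHalf))
    where
      Lower Upper : ℕ → Set
      Lower n = x n ∈ J × x n < midpoint J
      Upper n = x n ∈ J × ¬ x n < midpoint J

      split : ∀ {n} → x n ∈ J → Lower n ⊎ Upper n
      split {n} x∈J with x n <? midpoint J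
      ... | yes x<m = inj₁ (x∈J , x<m)
      ... | no x≮m = inj₂ (x∈J , x≮m)

      onHalf : (Side : ℚ → Set) → (∀ y → Dec (Side y)) → (H : Interval) →
               (∀ {y} → Side y → halfContaining y J ≡ H) →
               (∀ {y} → y ∈ J → Side y → y ∈ H) →
               AlmostFiniteFrom i (λ n → x n ∈ J × Side (x n))
      onHalf Side Side? H choose ⊆H =
        almostFiniteFrom-step (λ n → x n ∈? J ×-dec Side? (x n)) λ n i≤n (x∈J , side) →
          almostFiniteFrom-⊆ {P = λ k → x k ∈ H} {Q = λ k → x k ∈ J × Side (x k)}
                             (λ (y∈J , side) → ⊆H y∈J side)
            (subst (λ K → AlmostFiniteFrom (suc n) (λ k → x k ∈ K)) (choose side)
                   (children n i≤n (A-holds , x∈J)))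

  path : (ℕ → ℕ) → ℕ → Node
  path α = nodeAt ∘ initSeg α

  selected : (ℕ → ℕ) → ℕ → ℕ
  selected α zero = α zero
  selected α (suc j) = suc (selected α j) ℕ.+ α (suc j)

  selected-increasing : ∀ α → StrictlyIncreasing (selected α)
  selected-increasing α j = s≤s (ℕₚ.m≤m+n (selected α j) (α (suc j)))

  path-suc : ∀ α j → path α (suc j) ≡ extend (path α j) (selected α j)
  path-suc α j = trans (nodeAt-snoc (initSeg α j) (α j)) (cong (extend (path α j)) (chosen j))
    where
      chosen : ∀ j → next (path α j) ℕ.+ α j ≡ selected α j
      chosen zero = refl
      chosen (suc j) = cong (λ N → next N ℕ.+ α (suc j)) (path-suc α j)

  width-path : ∀ α j → width (interval (path α (suc j))) ≡ halfPow j
  width-path α j = begin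
    width (interval (path α (suc j)))                          ≡⟨ cong (width ∘ interval) (path-suc α j) ⟩
    width (halfContaining (x (selected α j)) (interval (path α j)))
                                                               ≡⟨ width-halfContaining {x (selected α j)} ⟩
    ½ * width (interval (path α j))                            ≡⟨ halved j ⟩
    halfPow j                                                  ∎
    where
      open ≡-Reasoning
      halved : ∀ j → ½ * width (interval (path α j)) ≡ halfPow j
      halved zero = refl
      halved (suc j) = cong (½ *_) (width-path α j)

  admissible-path-suc : ∀ α j → Admissible (path α (suc j)) →
                        Admissible (path α j) × x (selected α j) ∈ interval (path α j)
  admissible-path-suc α j = subst Admissible (path-suc α j)

  selected-∈-path : ∀ α j → Admissible (path α (suc j)) →
                    x (selected α j) ∈ interval (path α (suc j))
  selected-∈-path α j A-holds = subst (λ N → x (selected α j) ∈ interval N) (sym (path-suc α j))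
    (∈-halfContaining (proj₂ (admissible-path-suc α j A-holds)))

  inadmissible-path : ∀ α n → halfPow n < ∣ x (selected α n) - x (selected α (suc n)) ∣ →
                      ¬ Admissible (path α (suc (suc n)))
  inadmissible-path α n far A-holds =
    let A₁ , later∈I = admissible-path-suc α (suc n) A-holds
        close = ∈⇒∣-∣≤width (selected-∈-path α n A₁) later∈I
    in ℚₚ.<-irrefl refl (ℚₚ.<-≤-trans far
         (subst (∣ x (selected α n) - x (selected α (suc n)) ∣ ≤_) (width-path α n) close))

  sparse-root : BarInduction →
                (∀ ζ → StrictlyIncreasing ζ → ∃ λ n → halfPow n < ∣ x (ζ n) - x (ζ (suc n)) ∣) →
                Sparse root
  sparse-root BI far =
    barInduction-backward BI Inadmissible Goal inadmissible-bar inadmissible⇒goal backward tt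
    where
      Inadmissible Goal : List ℕ → Set
      Inadmissible s = ¬ Admissible (nodeAt s)
      Goal s = Admissible (nodeAt s) → Sparse (nodeAt s)

      inadmissible-bar : IsBar Inadmissible
      inadmissible-bar α =
        let n , apart = far (selected α) (selected-increasing α)
        in suc (suc n) , inadmissible-path α n apart

      inadmissible⇒goal : ∀ s t → Inadmissible s → Goal (s ++ t)
      inadmissible⇒goal s t ¬A A = ⊥-elim (¬A (admissible-prefix s t A))

      backward : ∀ s → (∀ d → Goal (s ++ [ d ])) → Goal s
      backward s children = sparse-backward (nodeAt s) λ n next≤n →
        let d , next+d≡n = ℕₚ.m≤n⇒∃[o]m+o≡n next≤n
        in subst (λ N → Admissible N → Sparse N)
                 (trans (nodeAt-snoc s d) (cong (extend (nodeAt s)) next+d≡n)) (children d)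

bolzanoWeierstrass : BarInduction → (x : ℕ → ℚ) →
  (∀ ζ → StrictlyIncreasing ζ → ∃ λ n → halfPow n < ∣ x (ζ n) - x (ζ (suc n)) ∣) →
  ∃ λ n → 1ℚ < ∣ x n ∣
bolzanoWeierstrass BI x far =
  let m , x∉[-1,1] = BisectionTree.sparse-root x BI far id ℕₚ.n<1+n z≤n
  in m , ∉[-1,1]⇒1<∣y∣ (x m) x∉[-1,1]

theorem7p15 : BarInduction →
    (q : ℕ → ℚ) → IsEnumerationℚ q →
    (γ : ℕ → ℕ) →
    (∀ (ζ : ℕ → ℕ) → StrictlyIncreasing ζ →
      ∃ λ n → halfPow n < ∣ q (γ (ζ n)) - q (γ (ζ (suc n))) ∣) →
    ∃ λ n → 1ℚ < ∣ q (γ n) ∣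
theorem7p15 BI q _ γ = bolzanoWeierstrass BI (q ∘ γ)
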